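{- For all nonnegative integers $m,n$, $$(\zeta^n*\xi_{ -1})(K_m) = (-1)^{n+m}\,(\zeta^m*\xi_{ -1})(K_n).$$
   Context: The graph algebra $\mathcal{G}$ over a field $\mathbb{F}$ of characteristic $0$ has basis the isomorphism classes of finite graphs, multiplication disjoint union, unit the empty graph $K_0$, comultiplication $\Delta(G)=\sum_{T\subseteq V(G)}G|_T\otimes G|_{V(G)\setminus T}$ ($G|_T$ the induced subgraph), counit $\epsilon(G)=1$ if $G$ has no vertices, $0$ otherwise. Characters are multiplicative linear maps $\mathcal{G}\to\mathbb{F}$; convolution is $(\phi*\psi)(G)=\sum_{T\subseteq V(G)}\phi(G|_T)\psi(G|_{V(G)\setminus T})$, $\phi^0=\epsilon$ and $\phi^n$ is the $n$-fold convolution power. The character $\zeta$ is $\zeta(G)=1$ if $G$ has no edges and $0$ otherwise; for nonzero $c\in\mathbb{F}$, $\xi_c(G)=c^{n(G)}$ where $n(G)$ is the number of vertices. $K_m$ is the complete graph on $m$ vertices ($K_0$ is the empty graph). -}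

module Defs where

open import Data.Nat as ℕ using (ℕ; zero; suc)
open import Data.Bool using (Bool; true; false; not; if_then_else_; _∨_)
open import Data.Fin using (Fin; _≟_)
open import Data.List as List using (List; []; _∷_; length; lookup; allFin; concatMap; map)
open import Data.Bool.ListAction using (any)
open import Data.Integer using (ℤ; +_; -_; _+_; _*_; _^_)
open import Relation.Nullary.Decidable using (⌊_⌋)
open import Relation.Binary.PropositionalEquality using (_≡_; refl; sym)
open import Data.Fin.Properties using (≡-isDecEquivalence)
open import Relation.Nullary using (yes; no)

record Graph : Set where
  field
    size  : ℕ
    adj   : Fin size → Fin size → Bool
    symm  : ∀ i j → adj i j ≡ adj j i
    irrefl : ∀ i → adj i i ≡ false
open Graph public

Subset : ℕ → Set
Subset n = Fin n → Bool

allSubsets : (n : ℕ) → List (Subset n)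
allSubsets zero = (λ ()) ∷ []
allSubsets (suc n) =
  concatMap (λ T → (λ { Fin.zero → true  ; (Fin.suc i) → T i })
                 ∷ (λ { Fin.zero → false ; (Fin.suc i) → T i }) ∷ []) (allSubsets n)

complement : ∀ {n} → Subset n → Subset n
complement T i = not (T i)

elems : ∀ {n} → Subset n → List (Fin n)
elems {n} T = List.filterᵇ T (allFin n)

induced : (G : Graph) → Subset (size G) → Graph
induced G T = record
  { size   = length (elems T)
  ; adj    = λ i j → adj G (lookup (elems T) i) (lookup (elems T) j)
  ; symm   = λ i j → symm G (lookup (elems T) i) (lookup (elems T) j)
  ; irrefl = λ i → irrefl G (lookup (elems T) i)
  }

-- Linear functionals on the graph algebra, determined by their values on
-- graphs (values in ℤ ⊆ 𝔽)

GraphFun : Set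
GraphFun = Graph → ℤ

sumℤ : List ℤ → ℤ
sumℤ = List.foldr _+_ (+ 0)

_⋆_ : GraphFun → GraphFun → GraphFun
(φ ⋆ ψ) G = sumℤ (map (λ T → φ (induced G T) * ψ (induced G (complement T)))
                      (allSubsets (size G)))

ε : GraphFun
ε G with size G
... | zero  = + 1
... | suc _ = + 0

_^⋆_ : GraphFun → ℕ → GraphFun
φ ^⋆ zero    = ε
φ ^⋆ (suc k) = φ ⋆ (φ ^⋆ k)

hasEdge : Graph → Bool
hasEdge G = any (λ i → any (λ j → adj G i j) (allFin (size G))) (allFin (size G))

ζ : GraphFun
ζ G = if hasEdge G then + 0 else + 1

ξ : ℤ → GraphFun
ξ c G = c ^ size G

private
  neq : ∀ {m} → Fin m → Fin m → Bool
  neq i j = not ⌊ i ≟ j ⌋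

  neq-sym : ∀ {m} (i j : Fin m) → neq i j ≡ neq j i
  neq-sym i j with i ≟ j | j ≟ i
  ... | yes _ | yes _ = refl
  ... | no _  | no _  = refl
  ... | yes p | no q  with q (sym p)
  ... | ()
  neq-sym i j | no p | yes q with p (sym q)
  ... | ()

  neq-irr : ∀ {m} (i : Fin m) → neq i i ≡ false
  neq-irr i with i ≟ i
  ... | yes _ = refl
  ... | no p with p refl
  ... | ()

K : ℕ → Graph
K m = record { size = m ; adj = neq ; symm = neq-sym ; irrefl = neq-irr }

-- Every induced subgraph of a complete graph is complete, so on complete
-- graphs a convolution of size-dependent functionals only sees the sizes of
-- the two halves of each splitting T ⊔ Tᶜ.
-- On K_k, ζ is 1 exactly when k ≤ 1, hence ζⁿ(K_k) is the falling factorial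
-- n(n-1)⋯(n-k+1) (an ordered partition of k vertices into n blocks of size
-- ≤ 1), and (ζⁿ * ξ₋₁)(K_m) = Λ m n := Σ_{T ⊆ [m]} n^{(|T|)} (-1)^{|Tᶜ|}.
-- Λ satisfies Λ(m+1,n+1) = (n+1)Λ(m,n) - Λ(m,n+1) with Λ(0,n) = 1 and
-- Λ(m,0) = (-1)^m.  After the twist f(m,n) = (-1)^m Λ(m,n) this becomes a
-- recurrence with boundary values 1 on both axes, and a general lemma shows
-- that its solution is symmetric; untwisting gives the corollary.
module Submission where

open import Data.Nat as ℕ using (ℕ; zero; suc)
open import Data.Integer using (ℤ; -_; +_; _*_; _^_; _+_; _-_)
open import Data.Integer.Properties
  using (*-identityˡ; *-identityʳ; *-zeroˡ; *-zeroʳ; +-identityˡ; +-identityʳ;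
         *-distribˡ-+; i≡j⇒i-j≡0; ^-distribˡ-+-*)
open import Data.Integer.Tactic.RingSolver using (solve-∀)
open import Data.Bool using (Bool; true; false; if_then_else_)
open import Data.Bool.Properties using (T?)
open import Data.Bool.ListAction using (any)
open import Data.Fin using (Fin; _≟_) renaming (zero to fzero; suc to fsuc)
open import Data.List using (List; []; _∷_; length; lookup; allFin; concatMap; map; tabulate; filterᵇ)
open import Data.List.Properties using (map-cong)
open import Data.List.Relation.Unary.All using (All; _∷_)
open import Data.List.Relation.Unary.AllPairs using (AllPairs; _∷_)
open import Data.List.Relation.Unary.Unique.Propositional.Properties using (filter⁺; allFin⁺)
open import Data.Empty using (⊥-elim)
open import Relation.Nullary using (yes; no; ¬_)
open import Relation.Binary.PropositionalEquality
  using (_≡_; refl; sym; trans; cong; cong₂; module ≡-Reasoning)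
open import Defs

open ≡-Reasoning

sign : ℕ → ℤ
sign k = (- (+ 1)) ^ k

sign-cancel : ∀ k x → sign k * (sign k * x) ≡ x
sign-cancel zero    x = trans (*-identityˡ _) (*-identityˡ x)
sign-cancel (suc k) x = begin
  (- (+ 1) * sign k) * ((- (+ 1) * sign k) * x) ≡⟨ rearrange (sign k) x ⟩
  sign k * (sign k * x)                         ≡⟨ sign-cancel k x ⟩
  x                                             ∎
  where
  rearrange : ∀ s x → (- (+ 1) * s) * ((- (+ 1) * s) * x) ≡ s * (s * x)
  rearrange = solve-∀

-- A recurrence with symmetric solution.
-- If f is 1 on both axes and f(m+1,n+1) = f(m,n+1) - (n+1) f(m,n), then f
-- also satisfies the transposed recurrence, and therefore f(m,n) = f(n,m).

module SymmetricRecurrence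
  (f : ℕ → ℕ → ℤ)
  (f-row₀ : ∀ n → f 0 n ≡ + 1)
  (f-col₀ : ∀ m → f m 0 ≡ + 1)
  (f-step : ∀ m n → f (suc m) (suc n) ≡ f m (suc n) - + suc n * f m n)
  where

  f-row₁ : ∀ n → f 1 n ≡ + 1 - + n
  f-row₁ zero    = f-col₀ 1
  f-row₁ (suc n) = begin
    f 1 (suc n)                 ≡⟨ f-step 0 n ⟩
    f 0 (suc n) - + suc n * f 0 n ≡⟨ cong₂ (λ u v → u - + suc n * v) (f-row₀ (suc n)) (f-row₀ n) ⟩
    + 1 - + suc n * + 1         ≡⟨ cong (λ x → + 1 - x) (*-identityʳ (+ suc n)) ⟩
    + 1 - + suc n               ∎

  f-col₁ : ∀ m → f m 1 ≡ + 1 - + m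
  f-col₁ zero    = f-row₀ 1
  f-col₁ (suc m) = begin
    f (suc m) 1               ≡⟨ f-step m 0 ⟩
    f m 1 - + 1 * f m 0       ≡⟨ cong₂ (λ u v → u - + 1 * v) (f-col₁ m) (f-col₀ m) ⟩
    (+ 1 - + m) - + 1 * + 1   ≡⟨ decrement (+ m) ⟩
    + 1 - + suc m             ∎
    where
    decrement : ∀ x → (+ 1 - x) - + 1 * + 1 ≡ + 1 - (+ 1 + x)
    decrement = solve-∀

  f-step′ : ∀ m n → f (suc m) (suc n) ≡ f (suc m) n - + suc m * f m n
  f-step′ zero zero = begin
    f 1 1         ≡⟨ f-row₁ 1 ⟩
    + 0           ≡⟨ cong₂ (λ u v → u - + 1 * v) (f-col₀ 1) (f-col₀ 0) ⟨
    f 1 0 - + 1 * f 0 0 ∎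
  f-step′ zero (suc n) = begin
    f 1 (suc (suc n))               ≡⟨ f-row₁ (suc (suc n)) ⟩
    + 1 - + suc (suc n)             ≡⟨ row-identity (+ n) ⟩
    (+ 1 - + suc n) - + 1 * + 1     ≡⟨ cong₂ (λ u v → u - + 1 * v) (f-row₁ (suc n)) (f-row₀ (suc n)) ⟨
    f 1 (suc n) - + 1 * f 0 (suc n) ∎
    where
    row-identity : ∀ x → + 1 - (+ 1 + (+ 1 + x)) ≡ (+ 1 - (+ 1 + x)) - + 1 * + 1
    row-identity = solve-∀
  f-step′ (suc m) zero = begin
    f (suc (suc m)) 1                            ≡⟨ f-col₁ (suc (suc m)) ⟩
    + 1 - + suc (suc m)                          ≡⟨ col-identity (+ m) ⟩
    + 1 - + suc (suc m) * + 1                    ≡⟨ cong₂ (λ u v → u - + suc (suc m) * v) (f-col₀ (suc (suc m))) (f-col₀ (suc m)) ⟨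
    f (suc (suc m)) 0 - + suc (suc m) * f (suc m) 0 ∎
    where
    col-identity : ∀ x → + 1 - (+ 1 + (+ 1 + x)) ≡ + 1 - (+ 1 + (+ 1 + x)) * + 1
    col-identity = solve-∀
  f-step′ (suc m) (suc n) = begin
    f (suc (suc m)) (suc (suc n))                       ≡⟨ f-step (suc m) (suc n) ⟩
    f (suc m) (suc (suc n)) - + suc (suc n) * X          ≡⟨ cong (_- + suc (suc n) * X) (f-step′ m (suc n)) ⟩
    (X - a * Y) - (+ 1 + b) * X                          ≡⟨ regroup X Y Z a b ⟩
    ((X - b * (X + a * Z)) - (+ 1 + a) * X) + a * (X - (Y - b * Z))
                                                         ≡⟨ cong₂ (λ w d → ((X - b * w) - (+ 1 + a) * X) + a * d)
                                                                  (sym W≡X+aZ) (i≡j⇒i-j≡0 (f-step m n)) ⟩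
    ((X - b * W) - (+ 1 + a) * X) + a * + 0              ≡⟨ drop-zero ((X - b * W) - (+ 1 + a) * X) a ⟩
    (X - b * W) - (+ 1 + a) * X                          ≡⟨ cong (λ u → u - (+ 1 + a) * X) (f-step (suc m) n) ⟨
    f (suc (suc m)) (suc n) - + suc (suc m) * X          ∎
    where
    a = + suc m
    b = + suc n
    X = f (suc m) (suc n)
    Y = f m (suc n)
    Z = f m n
    W = f (suc m) n

    W≡X+aZ : W ≡ X + a * Z
    W≡X+aZ = begin
      W                  ≡⟨ cancel W (a * Z) ⟩
      (W - a * Z) + a * Z ≡⟨ cong (_+ a * Z) (f-step′ m n) ⟨
      X + a * Z          ∎
      where
      cancel : ∀ w v → w ≡ (w - v) + v
      cancel = solve-∀

    drop-zero : ∀ x a → x + a * + 0 ≡ x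
    drop-zero = solve-∀

    regroup : ∀ X Y Z a b →
      (X - a * Y) - (+ 1 + b) * X
        ≡ ((X - b * (X + a * Z)) - (+ 1 + a) * X) + a * (X - (Y - b * Z))
    regroup = solve-∀

  symmetric : ∀ m n → f m n ≡ f n m
  symmetric zero    n       = trans (f-row₀ n) (sym (f-col₀ n))
  symmetric (suc m) zero    = trans (f-col₀ (suc m)) (sym (f-row₀ (suc m)))
  symmetric (suc m) (suc n) = begin
    f (suc m) (suc n)                 ≡⟨ f-step m n ⟩
    f m (suc n) - + suc n * f m n     ≡⟨ cong₂ (λ u v → u - + suc n * v) (symmetric m (suc n)) (symmetric m n) ⟩
    f (suc n) m - + suc n * f n m     ≡⟨ f-step′ n m ⟨
    f (suc n) (suc m)                 ∎

-- Sums over the subsets of a k-set that depend only on the sizes of the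
-- subset and of its complement:  sizeSum k F = Σ_{T ⊆ [k]} F |T| |Tᶜ|.

sizeSum : ℕ → (ℕ → ℕ → ℤ) → ℤ
sizeSum zero    F = F 0 0
sizeSum (suc k) F = sizeSum k (λ a b → F (suc a) b) + sizeSum k (λ a b → F a (suc b))

sizeSum-cong : ∀ k {F G : ℕ → ℕ → ℤ} → (∀ a b → F a b ≡ G a b) → sizeSum k F ≡ sizeSum k G
sizeSum-cong zero    F≗G = F≗G 0 0
sizeSum-cong (suc k) F≗G =
  cong₂ _+_ (sizeSum-cong k (λ a b → F≗G (suc a) b)) (sizeSum-cong k (λ a b → F≗G a (suc b)))

sizeSum-scale : ∀ k c (F : ℕ → ℕ → ℤ) → sizeSum k (λ a b → c * F a b) ≡ c * sizeSum k F
sizeSum-scale zero    c F = refl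
sizeSum-scale (suc k) c F =
  trans (cong₂ _+_ (sizeSum-scale k c _) (sizeSum-scale k c _)) (sym (*-distribˡ-+ c _ _))

sizeSum-zero : ∀ k → sizeSum k (λ _ _ → + 0) ≡ + 0
sizeSum-zero zero    = refl
sizeSum-zero (suc k) = cong₂ _+_ (sizeSum-zero k) (sizeSum-zero k)

sizeSum-empty : ∀ k (F : ℕ → ℕ → ℤ) → (∀ a b → F (suc a) b ≡ + 0) → sizeSum k F ≡ F 0 k
sizeSum-empty zero    F F-vanishes = refl
sizeSum-empty (suc k) F F-vanishes = begin
  sizeSum k (λ a b → F (suc a) b) + sizeSum k (λ a b → F a (suc b))
    ≡⟨ cong₂ _+_ (trans (sizeSum-cong k F-vanishes) (sizeSum-zero k))
                 (sizeSum-empty k (λ a b → F a (suc b)) (λ a b → F-vanishes a (suc b))) ⟩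
  + 0 + F 0 (suc k)
    ≡⟨ +-identityˡ _ ⟩
  F 0 (suc k) ∎

ζK : ℕ → ℤ
ζK zero          = + 1
ζK (suc zero)    = + 1
ζK (suc (suc _)) = + 0

falling : ℕ → ℕ → ℤ
falling n       zero    = + 1
falling zero    (suc k) = + 0
falling (suc n) (suc k) = + suc n * falling n k

falling-pascal : ∀ n k → falling n (suc k) + + k * falling n k ≡ + n * falling n k
falling-pascal zero    zero    = refl
falling-pascal zero    (suc k) = trans (+-identityˡ _) (*-zeroʳ (+ suc k))
falling-pascal (suc n) zero    = +-identityʳ _
falling-pascal (suc n) (suc k) = begin
  + suc n * falling n (suc k) + + suc k * (+ suc n * F)
    ≡⟨ factor (+ suc n) (falling n (suc k)) (+ k) F ⟩
  + suc n * ((falling n (suc k) + + k * F) + F)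
    ≡⟨ cong (λ x → + suc n * (x + F)) (falling-pascal n k) ⟩
  + suc n * (+ n * F + F)
    ≡⟨ cong (+ suc n *_) (absorb (+ n) F) ⟩
  + suc n * (+ suc n * F) ∎
  where
  F = falling n k
  factor : ∀ c x k F → c * x + (+ 1 + k) * (c * F) ≡ c * ((x + k * F) + F)
  factor = solve-∀
  absorb : ∀ n F → n * F + F ≡ (+ 1 + n) * F
  absorb = solve-∀

-- Convolving ζK with G: a size-(k+1) set either has no singleton in front
-- (G (k+1)) or one of its k+1 elements forms the singleton (G k).
ζK-convolution : ∀ k (G : ℕ → ℤ) → sizeSum (suc k) (λ a b → ζK a * G b) ≡ G (suc k) + + suc k * G k
ζK-convolution k G = begin
  sizeSum k (λ a b → ζK (suc a) * G b) + sizeSum k (λ a b → ζK a * G (suc b))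
    ≡⟨ cong (_+ sizeSum k (λ a b → ζK a * G (suc b))) singleton-first ⟩
  G k + sizeSum k (λ a b → ζK a * G (suc b))
    ≡⟨ rest k ⟩
  G (suc k) + + suc k * G k ∎
  where
  singleton-first : sizeSum k (λ a b → ζK (suc a) * G b) ≡ G k
  singleton-first = trans (sizeSum-empty k _ (λ a b → *-zeroˡ (G b))) (*-identityˡ (G k))

  rest : ∀ k → G k + sizeSum k (λ a b → ζK a * G (suc b)) ≡ G (suc k) + + suc k * G k
  rest zero    = begin
    G 0 + + 1 * G 1 ≡⟨ swap (G 0) (G 1) ⟩
    G 1 + + 1 * G 0 ∎
    where
    swap : ∀ x y → x + + 1 * y ≡ y + + 1 * x
    swap = solve-∀
  rest (suc k) = begin
    G (suc k) + sizeSum (suc k) (λ a b → ζK a * G (suc b))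
      ≡⟨ cong (λ x → G (suc k) + x) (ζK-convolution k (λ b → G (suc b))) ⟩
    G (suc k) + (G (suc (suc k)) + + suc k * G (suc k))
      ≡⟨ collect (G (suc k)) (G (suc (suc k))) (+ suc k) ⟩
    G (suc (suc k)) + + suc (suc k) * G (suc k) ∎
    where
    collect : ∀ x y c → x + (y + c * x) ≡ y + (+ 1 + c) * x
    collect = solve-∀

ζK-falling : ∀ n k → sizeSum k (λ a b → ζK a * falling n b) ≡ falling (suc n) k
ζK-falling n zero    = *-identityˡ (+ 1)
ζK-falling n (suc k) = begin
  sizeSum (suc k) (λ a b → ζK a * falling n b)  ≡⟨ ζK-convolution k (falling n) ⟩
  falling n (suc k) + + suc k * falling n k      ≡⟨ step (falling n (suc k)) (falling n k) (+ k) (+ n) (falling-pascal n k) ⟩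
  + suc n * falling n k                          ∎
  where
  step : ∀ x F k n → x + k * F ≡ n * F → x + (+ 1 + k) * F ≡ (+ 1 + n) * F
  step x F k n eq = begin
    x + (+ 1 + k) * F ≡⟨ split x F k ⟩
    (x + k * F) + F   ≡⟨ cong (_+ F) eq ⟩
    n * F + F         ≡⟨ absorb F n ⟩
    (+ 1 + n) * F     ∎
    where
    split : ∀ x F k → x + (+ 1 + k) * F ≡ (x + k * F) + F
    split = solve-∀
    absorb : ∀ F n → n * F + F ≡ (+ 1 + n) * F
    absorb = solve-∀

Λ : ℕ → ℕ → ℤ
Λ m n = sizeSum m (λ a b → falling n a * sign b)

Λ-col₀ : ∀ m → Λ m 0 ≡ sign m
Λ-col₀ m = trans (sizeSum-empty m _ (λ a b → *-zeroˡ (sign b))) (*-identityˡ (sign m))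

Λ-step : ∀ m n → Λ (suc m) (suc n) ≡ + suc n * Λ m n - Λ m (suc n)
Λ-step m n = begin
  sizeSum m (λ a b → + suc n * falling n a * sign b) + sizeSum m (λ a b → falling (suc n) a * (- (+ 1) * sign b))
    ≡⟨ cong₂ _+_ (sizeSum-scale′ (+ suc n) (λ a b → falling n a * sign b) λ a b → assoc (+ suc n) (falling n a) (sign b))
                 (sizeSum-scale′ (- (+ 1)) (λ a b → falling (suc n) a * sign b) λ a b → pull-sign (falling (suc n) a) (sign b)) ⟩
  + suc n * Λ m n + - (+ 1) * Λ m (suc n)
    ≡⟨ minus (+ suc n * Λ m n) (Λ m (suc n)) ⟩
  + suc n * Λ m n - Λ m (suc n) ∎
  where
  sizeSum-scale′ : ∀ c F {G : ℕ → ℕ → ℤ} → (∀ a b → G a b ≡ c * F a b) → sizeSum m G ≡ c * sizeSum m F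
  sizeSum-scale′ c F G≗cF = trans (sizeSum-cong m G≗cF) (sizeSum-scale m c F)
  assoc : ∀ c x y → c * x * y ≡ c * (x * y)
  assoc = solve-∀
  pull-sign : ∀ x y → x * (- (+ 1) * y) ≡ - (+ 1) * (x * y)
  pull-sign = solve-∀
  minus : ∀ x y → x + - (+ 1) * y ≡ x - y
  minus = solve-∀

twisted : ℕ → ℕ → ℤ
twisted m n = sign m * Λ m n

twisted-row₀ : ∀ n → twisted 0 n ≡ + 1
twisted-row₀ n = refl

twisted-col₀ : ∀ m → twisted m 0 ≡ + 1
twisted-col₀ m = begin
  sign m * Λ m 0          ≡⟨ cong (sign m *_) (Λ-col₀ m) ⟩
  sign m * sign m         ≡⟨ cong (sign m *_) (*-identityʳ (sign m)) ⟨
  sign m * (sign m * + 1) ≡⟨ sign-cancel m (+ 1) ⟩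
  + 1                     ∎

twisted-step : ∀ m n → twisted (suc m) (suc n) ≡ twisted m (suc n) - + suc n * twisted m n
twisted-step m n = begin
  - (+ 1) * sign m * Λ (suc m) (suc n)               ≡⟨ cong (- (+ 1) * sign m *_) (Λ-step m n) ⟩
  - (+ 1) * sign m * (+ suc n * Λ m n - Λ m (suc n)) ≡⟨ untwist (sign m) (+ suc n) (Λ m n) (Λ m (suc n)) ⟩
  sign m * Λ m (suc n) - + suc n * (sign m * Λ m n)  ∎
  where
  untwist : ∀ s c x y → - (+ 1) * s * (c * x - y) ≡ s * y - c * (s * x)
  untwist = solve-∀

open SymmetricRecurrence twisted twisted-row₀ twisted-col₀ twisted-step
  using () renaming (symmetric to twisted-symmetric)

Λ-reciprocity : ∀ m n → Λ m n ≡ sign (n ℕ.+ m) * Λ n m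
Λ-reciprocity m n = begin
  Λ m n                       ≡⟨ sign-cancel m (Λ m n) ⟨
  sign m * (sign m * Λ m n)   ≡⟨ cong (sign m *_) (twisted-symmetric m n) ⟩
  sign m * (sign n * Λ n m)   ≡⟨ rearrange (sign m) (sign n) (Λ n m) ⟩
  (sign n * sign m) * Λ n m   ≡⟨ cong (_* Λ n m) (^-distribˡ-+-* (- (+ 1)) n m) ⟨
  sign (n ℕ.+ m) * Λ n m      ∎
  where
  rearrange : ∀ s t x → s * (t * x) ≡ (t * s) * x
  rearrange = solve-∀

-- |T|, counted along the vertex order used by 'allSubsets'.
count : ∀ {n} → Subset n → ℕ
count {zero}  T = 0
count {suc n} T = (if T fzero then 1 else 0) ℕ.+ count (λ i → T (fsuc i))

sum-pairs : ∀ {A C : Set} (h : C → ℤ) (f g : A → C) (xs : List A) →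
  sumℤ (map h (concatMap (λ x → f x ∷ g x ∷ []) xs))
    ≡ sumℤ (map (λ x → h (f x)) xs) + sumℤ (map (λ x → h (g x)) xs)
sum-pairs h f g []       = refl
sum-pairs h f g (x ∷ xs) = begin
  h (f x) + (h (g x) + sumℤ (map h (concatMap (λ x → f x ∷ g x ∷ []) xs)))
    ≡⟨ cong (λ r → h (f x) + (h (g x) + r)) (sum-pairs h f g xs) ⟩
  h (f x) + (h (g x) + (sumℤ (map (λ x → h (f x)) xs) + sumℤ (map (λ x → h (g x)) xs)))
    ≡⟨ interleave (h (f x)) (h (g x)) _ _ ⟩
  (h (f x) + sumℤ (map (λ x → h (f x)) xs)) + (h (g x) + sumℤ (map (λ x → h (g x)) xs)) ∎
  where
  interleave : ∀ a b c d → a + (b + (c + d)) ≡ (a + c) + (b + d)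
  interleave = solve-∀

allSubsets-sizeSum : ∀ n (F : ℕ → ℕ → ℤ) →
  sumℤ (map (λ T → F (count T) (count (complement T))) (allSubsets n)) ≡ sizeSum n F
allSubsets-sizeSum zero    F = +-identityʳ (F 0 0)
allSubsets-sizeSum (suc n) F =
  trans (sum-pairs _ _ _ (allSubsets n))
        (cong₂ _+_ (allSubsets-sizeSum n (λ a b → F (suc a) b))
                   (allSubsets-sizeSum n (λ a b → F a (suc b))))

length-filter-tabulate : ∀ {A : Set} {n} (f : Fin n → A) (p : A → Bool) →
  length (filterᵇ p (tabulate f)) ≡ count (λ i → p (f i))
length-filter-tabulate {n = zero}  f p = refl
length-filter-tabulate {n = suc n} f p with p (f fzero)
... | true  = cong suc (length-filter-tabulate (λ i → f (fsuc i)) p)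
... | false = length-filter-tabulate (λ i → f (fsuc i)) p

length-elems : ∀ {n} (T : Subset n) → length (elems T) ≡ count T
length-elems T = length-filter-tabulate (λ i → i) T

IsComplete : Graph → Set
IsComplete H = ∀ i j → ¬ i ≡ j → adj H i j ≡ true

K-complete : ∀ m → IsComplete (K m)
K-complete m i j i≢j with i ≟ j
... | yes i≡j = ⊥-elim (i≢j i≡j)
... | no  _   = refl

lookup-injective : ∀ {A : Set} {xs : List A} → AllPairs (λ x y → ¬ x ≡ y) xs →
  ∀ i j → lookup xs i ≡ lookup xs j → i ≡ j
lookup-injective (_ ∷ _) fzero fzero _ = refl
lookup-injective (x∉xs ∷ _) fzero (fsuc j) eq = ⊥-elim (all-lookup x∉xs j eq)
  where
  all-lookup : ∀ {A : Set} {P : A → Set} {xs : List A} → All P xs → (i : Fin (length xs)) → P (lookup xs i)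
  all-lookup (px ∷ _)   fzero    = px
  all-lookup (_  ∷ pxs) (fsuc i) = all-lookup pxs i
lookup-injective (x∉xs ∷ u) (fsuc i) fzero eq = sym (lookup-injective (x∉xs ∷ u) fzero (fsuc i) (sym eq))
lookup-injective (_ ∷ u) (fsuc i) (fsuc j) eq = cong fsuc (lookup-injective u i j eq)

induced-complete : ∀ G → IsComplete G → (T : Subset (size G)) → IsComplete (induced G T)
induced-complete G G-complete T i j i≢j =
  G-complete (lookup (elems T) i) (lookup (elems T) j)
    (λ eq → i≢j (lookup-injective (filter⁺ (λ x → T? (T x)) (allFin⁺ (size G))) i j eq))

DeterminedBySize : GraphFun → (ℕ → ℤ) → Set
DeterminedBySize φ f = ∀ H → IsComplete H → φ H ≡ f (size H)

convolution-complete : ∀ (φ ψ : GraphFun) (f g : ℕ → ℤ) →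
  DeterminedBySize φ f → DeterminedBySize ψ g →
  ∀ G → IsComplete G → (φ ⋆ ψ) G ≡ sizeSum (size G) (λ a b → f a * g b)
convolution-complete φ ψ f g φ≡f ψ≡g G G-complete =
  trans (cong sumℤ (map-cong term (allSubsets (size G))))
        (allSubsets-sizeSum (size G) (λ a b → f a * g b))
  where
  side : ∀ (χ : GraphFun) h → DeterminedBySize χ h → (T : Subset (size G)) → χ (induced G T) ≡ h (count T)
  side χ h χ≡h T = trans (χ≡h _ (induced-complete G G-complete T)) (cong h (length-elems T))

  term : ∀ T → φ (induced G T) * ψ (induced G (complement T)) ≡ f (count T) * g (count (complement T))
  term T = cong₂ _*_ (side φ f φ≡f T) (side ψ g ψ≡g (complement T))

ε-size : ∀ H → ε H ≡ falling 0 (size H)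
ε-size H with size H
... | zero  = refl
... | suc _ = refl

ε-complete : DeterminedBySize ε (falling 0)
ε-complete H _ = ε-size H

-- A complete graph has an edge iff it has at least two vertices.
ζ-complete : DeterminedBySize ζ ζK
ζ-complete H H-complete = edge-test (size H) (adj H) (irrefl H) H-complete
  where
  edge-test : ∀ k (a : Fin k → Fin k → Bool) → (∀ i → a i i ≡ false) → (∀ i j → ¬ i ≡ j → a i j ≡ true) →
    (if any (λ i → any (λ j → a i j) (allFin k)) (allFin k) then + 0 else + 1) ≡ ζK k
  edge-test zero          a a-irrefl a-complete = refl
  edge-test (suc zero)    a a-irrefl a-complete rewrite a-irrefl fzero = refl
  edge-test (suc (suc k)) a a-irrefl a-complete
    rewrite a-irrefl fzero | a-complete fzero (fsuc fzero) (λ ()) = refl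

ζ-power-complete : ∀ n → DeterminedBySize (ζ ^⋆ n) (falling n)
ζ-power-complete zero    = ε-complete
ζ-power-complete (suc n) H H-complete =
  trans (convolution-complete ζ (ζ ^⋆ n) ζK (falling n) ζ-complete (ζ-power-complete n) H H-complete)
        (ζK-falling n (size H))

convolution-on-K : ∀ m n → ((ζ ^⋆ n) ⋆ ξ (- (+ 1))) (K m) ≡ Λ m n
convolution-on-K m n =
  convolution-complete (ζ ^⋆ n) (ξ (- (+ 1))) (falling n) sign
    (ζ-power-complete n) (λ H _ → refl) (K m) (K-complete m)


corollary5p2 : (m n : ℕ) →
    ((ζ ^⋆ n) ⋆ ξ (- (+ 1))) (K m) ≡ ((- (+ 1)) ^ (n ℕ.+ m)) * ((ζ ^⋆ m) ⋆ ξ (- (+ 1))) (K n)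
corollary5p2 m n = begin
  ((ζ ^⋆ n) ⋆ ξ (- (+ 1))) (K m)                      ≡⟨ convolution-on-K m n ⟩
  Λ m n                                               ≡⟨ Λ-reciprocity m n ⟩
  sign (n ℕ.+ m) * Λ n m                              ≡⟨ cong (sign (n ℕ.+ m) *_) (convolution-on-K n m) ⟨
  sign (n ℕ.+ m) * ((ζ ^⋆ m) ⋆ ξ (- (+ 1))) (K n)     ∎
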